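{- Let $\mathcal{P}$ be a profile of unrooted phylogenetic trees whose display graph $G(\mathcal{P})$ is connected. Let $F$ be a nice minimal cut of $G(\mathcal{P})$ and let $G_1,G_2$ be the two connected components of $G(\mathcal{P})-F$. Then $\mathcal{L}(G_1)|\mathcal{L}(G_2)$ is a split of $\mathcal{L}(\mathcal{P})$.
   Context: A phylogenetic tree $T$ is an unrooted tree whose leaves are bijectively labelled by a finite set $\mathcal{L}(T)$; leaves are identified with labels. A profile is a finite collection $\mathcal{P}=\{T_1,\dots,T_k\}$ of phylogenetic trees with pairwise disjoint sets of internal vertices; $\mathcal{L}(\mathcal{P})=\bigcup_i\mathcal{L}(T_i)$. The display graph $G(\mathcal{P})$ has vertex set $\bigcup_iV(T_i)$ and edge set $\bigcup_iE(T_i)$; for a subgraph $H$, $\mathcal{L}(H)$ is the set of labels that are vertices of $H$. A split of a set $L$ is a bipartition of $L$ into two nonempty sets, written $X|Y$. A cut of a connected graph $G$ is $F\subseteq E(G)$ with $G-F$ (vertex set $V(G)$, edges $E(G)\setminus F$) disconnected; minimal if no proper subset is a cut. $\mathrm{Inc}(u)$ is the set of edges of $G(\mathcal{P})$ incident to $u$. A cut $F$ of $G(\mathcal{P})$ is nice if for each $T\in\mathcal{P}$ there is $u\in V(T)$ with $F\cap E(T)\subseteq\mathrm{Inc}(u)$, and each connected component of $G(\mathcal{P})-F$ has at least one edge. -}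

module Defs where

open import Data.Nat using (ℕ; suc)
open import Data.Fin using (Fin; zero; suc; inject₁; fromℕ)
open import Data.Bool using (Bool; true; false; T; _∧_; _∨_; not)
open import Data.Product using (Σ; _×_; _,_; ∃; ∃-syntax)
open import Data.Sum using (_⊎_)
open import Relation.Binary.PropositionalEquality using (_≡_)
open import Relation.Nullary using (¬_)
import Data.Empty
open import Function.Definitions using (Injective)

-- All vertices of all trees of a profile live in a common finite
-- universe  Fin n.  A vertex set is a Boolean predicate on Fin n, an
-- edge set is a symmetric Boolean relation on Fin n (E u v = true
-- means that the unordered pair {u,v} is an edge).

VSet : ℕ → Set
VSet n = Fin n → Bool

ESet : ℕ → Set
ESet n = Fin n → Fin n → Bool

record Graph (n : ℕ) : Set where
  field
    V : VSet n
    E : ESet n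

data Walk {n : ℕ} (E : ESet n) : Fin n → Fin n → Set where
  here : ∀ {a} → Walk E a a
  step : ∀ {a b c} → T (E a b) → Walk E b c → Walk E a c

WellFormed : ∀ {n} → Graph n → Set
WellFormed {n} G =
  (∀ (u v : Fin n) → Graph.E G u v ≡ Graph.E G v u) ×
  (∀ (u : Fin n) → Graph.E G u u ≡ false) ×
  (∀ (u v : Fin n) → T (Graph.E G u v) → T (Graph.V G u))

Connected : ∀ {n} → Graph n → Set
Connected {n} G =
  ∀ (u v : Fin n) → T (Graph.V G u) → T (Graph.V G v) → Walk (Graph.E G) u v

HasCycle : ∀ {n} → Graph n → Set
HasCycle {n} G =
  Σ ℕ λ m → Σ (Fin (suc (suc (suc m))) → Fin n) λ x →
    Injective _≡_ _≡_ x ×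
    (∀ (i : Fin (suc (suc m))) → T (Graph.E G (x (inject₁ i)) (x (suc i)))) ×
    T (Graph.E G (x (fromℕ (suc (suc m)))) (x zero))

IsTree : ∀ {n} → Graph n → Set
IsTree {n} G =
  WellFormed G × (Σ (Fin n) λ v → T (Graph.V G v)) × Connected G × ¬ HasCycle G

-- Leaves of a tree: vertices of degree at most one (a one-vertex tree
-- consists of a single leaf).  Leaves are identified with labels, so
-- L(T) is the set of leaves of T.
IsLeaf : ∀ {n} → Graph n → Fin n → Set
IsLeaf {n} G u =
  T (Graph.V G u) ×
  (∀ (v w : Fin n) → T (Graph.E G u v) → T (Graph.E G u w) → v ≡ w)

anyFin : ∀ k → (Fin k → Bool) → Bool
anyFin ℕ.zero    f = false
anyFin (suc k) f = f zero ∨ anyFin k (λ i → f (suc i))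

-- Distinct trees only share labels (leaves): a vertex lying in two
-- different trees is a leaf of both; in particular internal vertices
-- of distinct trees are pairwise disjoint.
record Profile (n k : ℕ) : Set where
  field
    tree      : Fin k → Graph n
    isTree    : ∀ (i : Fin k) → IsTree (tree i)
    disjoint  : ∀ (i j : Fin k) → ¬ (i ≡ j) → ∀ (u : Fin n) →
                T (Graph.V (tree i) u) → T (Graph.V (tree j) u) →
                IsLeaf (tree i) u × IsLeaf (tree j) u

module _ {n k : ℕ} (P : Profile n k) where
  open Profile P

  InLabels : Fin n → Set
  InLabels u = ∃[ i ] IsLeaf (tree i) u

  displayGraph : Graph n
  displayGraph = record
    { V = λ u → anyFin k (λ i → Graph.V (tree i) u)
    ; E = λ u v → anyFin k (λ i → Graph.E (tree i) u v)
    }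

module _ {n : ℕ} (G : Graph n) where
  open Graph G

  minus : ESet n → Graph n
  minus F = record { V = V ; E = λ u v → E u v ∧ not (F u v) }

  IsEdgeSubset : ESet n → Set
  IsEdgeSubset F = (∀ (u v : Fin n) → F u v ≡ F v u) ×
                   (∀ (u v : Fin n) → T (F u v) → T (E u v))

  IsCut : ESet n → Set
  IsCut F = IsEdgeSubset F × ¬ Connected (minus F)

  IsMinimalCut : ESet n → Set
  IsMinimalCut F = IsCut F ×
    (∀ (F' : ESet n) → IsEdgeSubset F' →
       (∀ (u v : Fin n) → T (F' u v) → T (F u v)) → IsCut F' →
       ∀ (u v : Fin n) → T (F u v) → T (F' u v))

  IsComponent : Graph n → VSet n → Set
  IsComponent H C =
    (Σ (Fin n) λ v → T (C v)) ×
    (∀ (v : Fin n) → T (C v) → T (Graph.V H v)) ×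
    (∀ (u v : Fin n) → T (C u) → T (C v) → Walk (Graph.E H) u v) ×
    (∀ (u v : Fin n) → T (C u) → T (Graph.V H v) → Walk (Graph.E H) u v → T (C v))

IncidentTo : ∀ {n} → ESet n → Graph n → Fin n → Set
IncidentTo {n} F Tr u =
  ∀ (x y : Fin n) → T (F x y) → T (Graph.E Tr x y) → (x ≡ u) ⊎ (y ≡ u)

module _ {n k : ℕ} (P : Profile n k) where
  open Profile P

  IsNiceCut : ESet n → Set
  IsNiceCut F =
    IsCut (displayGraph P) F ×
    (∀ (i : Fin k) → Σ (Fin n) λ u → T (Graph.V (tree i) u) × IncidentTo F (tree i) u) ×
    (∀ (C : VSet n) → IsComponent (displayGraph P) (minus (displayGraph P) F) C →
       Σ (Fin n) λ x → Σ (Fin n) λ y →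
         T (C x) × T (Graph.E (minus (displayGraph P) F) x y))

  LabelsIn : VSet n → Fin n → Set
  LabelsIn C u = T (C u) × InLabels P u

  IsSplit : (Fin n → Set) → (Fin n → Set) → Set
  IsSplit X Y =
    (Σ (Fin n) X) × (Σ (Fin n) Y) ×
    (∀ (u : Fin n) → X u → Y u → Data.Empty.⊥) ×
    (∀ (u : Fin n) → X u → InLabels P u) ×
    (∀ (u : Fin n) → Y u → InLabels P u) ×
    (∀ (u : Fin n) → InLabels P u → X u ⊎ Y u)

module Submission where

-- Let C be a component of G(P) − F and xy an edge of C, coming from a tree T of P,
-- and let u be a vertex such that every edge of F ∩ E(T) contains u.  Walk from xy
-- through T without backtracking and without crossing F: the walk stays in C, and
-- since T is a tree it is a path, so it must stop, either at a leaf of T (a label in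
-- C) or in front of an edge of F.  Extending the resulting path the same way from its
-- other end, if it again stops in front of an edge of F then the two end edges of one
-- path both contain u, which is impossible.  So G₁ and G₂ both contain labels.

open import Defs
open import Data.Nat using (ℕ; zero; suc; _+_; _<_; _≤_; s≤s; z<s)
open import Data.Nat.Properties using (+-suc; suc-injective; m<m+n; <⇒≱)
open import Data.Fin using (Fin; zero; suc; toℕ; inject₁; inject≤; fromℕ; _≟_)
open import Data.Fin.Properties
  using ( toℕ-injective; injective⇒≤; toℕ<n; toℕ-fromℕ; toℕ-inject₁; toℕ-inject≤
        ; inject≤-injective; any?)
open import Data.Bool using (Bool; true; false; T; not)
open import Data.Bool.Properties using (T-∧; T-∨; T?)
open import Data.Unit using (tt)
open import Data.Product using (_×_; _,_; ∃; proj₁; proj₂)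
open import Data.Sum using (_⊎_; inj₁; inj₂; [_,_])
open import Data.Empty using (⊥; ⊥-elim)
open import Data.List using (List; []; _∷_; _++_; _∷ʳ_; length; lookup; reverse; reverseAcc)
open import Data.List.Properties using (∷ʳ-++; reverse-++)
open import Data.List.Membership.Propositional using (_∈_)
open import Data.List.Membership.Propositional.Properties using (∈-lookup; ∈-++⁺ˡ; ∈-++⁺ʳ)
open import Data.List.Relation.Unary.Any using (here; there; index)
import Data.List.Relation.Unary.Any.Properties as Any
import Data.List.Relation.Unary.All as All
open import Data.List.Relation.Unary.Linked as Linked using (Linked; []; [-]; _∷_)
open import Data.List.Relation.Unary.Unique.Propositional using (Unique; []; _∷_)
open import Data.List.Relation.Binary.Permutation.Propositional using (↭-sym; ↭⇒↭ₛ)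
open import Data.List.Relation.Binary.Permutation.Propositional.Properties using (↭-reverse)
import Data.List.Relation.Binary.Permutation.Setoid.Properties as PermutationSetoid
open import Function using (_∘_; flip)
open import Function.Bundles using (Equivalence)
open import Function.Definitions using (Injective)
open import Relation.Binary.PropositionalEquality
  using (_≡_; _≢_; refl; sym; trans; cong; subst; setoid; module ≡-Reasoning)
open import Relation.Nullary using (¬_; yes; no; ¬?)
open import Relation.Nullary.Decidable using (_×-dec_; decidable-stable)

open Equivalence using (to; from)

module _ {A : Set} where

  lookup-injective : ∀ {xs : List A} → Unique xs → Injective _≡_ _≡_ (lookup xs)
  lookup-injective (_ ∷ _)  {zero}  {zero}  _  = refl
  lookup-injective (x∉ ∷ _) {zero}  {suc j} eq = ⊥-elim (All.lookup x∉ (∈-lookup j) eq)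
  lookup-injective (x∉ ∷ _) {suc i} {zero}  eq = ⊥-elim (All.lookup x∉ (∈-lookup i) (sym eq))
  lookup-injective (_ ∷ u)  {suc i} {suc j} eq = cong suc (lookup-injective u eq)

  lookup-linked : ∀ {R : A → A → Set} {xs} → Linked R xs → (i j : Fin (length xs)) →
                  toℕ j ≡ suc (toℕ i) → R (lookup xs i) (lookup xs j)
  lookup-linked (r ∷ _)  zero    (suc zero) _  = r
  lookup-linked (_ ∷ rs) (suc i) (suc j)    eq = lookup-linked rs i j (suc-injective eq)

  linked-reverse : ∀ {R : A → A → Set} {xs} → Linked R xs → Linked (flip R) (reverse xs)
  linked-reverse {R} {[]}    _      = []
  linked-reverse {R} {_ ∷ _} linked = onto linked [-]
    where
    onto : ∀ {x acc ys} → Linked R (x ∷ ys) → Linked (flip R) (x ∷ acc) →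
           Linked (flip R) (reverseAcc (x ∷ acc) ys)
    onto [-]        racc = racc
    onto (r ∷ rest) racc = onto rest (r ∷ racc)

  unique-reverse : ∀ {xs : List A} → Unique xs → Unique (reverse xs)
  unique-reverse {xs} = PermutationSetoid.Unique-resp-↭ (setoid A) (↭⇒↭ₛ (↭-sym (↭-reverse xs)))

  unique-++-disjoint : ∀ xs {ys : List A} {v} → Unique (xs ++ ys) → v ∈ xs → v ∈ ys → ⊥
  unique-++-disjoint (_ ∷ xs) (x∉ ∷ _) (here refl) v∈ys = All.lookup x∉ (∈-++⁺ʳ xs v∈ys) refl
  unique-++-disjoint (_ ∷ xs) (_ ∷ u)  (there v∈xs) v∈ys = unique-++-disjoint xs u v∈xs v∈ys

unique⇒length≤ : ∀ {n} {xs : List (Fin n)} → Unique xs → length xs ≤ n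
unique⇒length≤ u = injective⇒≤ (lookup-injective u)

T-or-T-not : ∀ b → T b ⊎ T (not b)
T-or-T-not true  = inj₁ tt
T-or-T-not false = inj₂ tt

anyFin-intro : ∀ {k} (f : Fin k → Bool) (i : Fin k) → T (f i) → T (anyFin k f)
anyFin-intro f zero    fi = from T-∨ (inj₁ fi)
anyFin-intro f (suc i) fi = from T-∨ (inj₂ (anyFin-intro (f ∘ suc) i fi))

anyFin-elim : ∀ {k} (f : Fin k → Bool) → T (anyFin k f) → ∃ λ i → T (f i)
anyFin-elim {suc k} f any with to T-∨ any
... | inj₁ f0   = zero , f0
... | inj₂ rest with anyFin-elim (f ∘ suc) rest
...   | i , fi = suc i , fi

module Forest {n} (G : Graph n) (wellFormed : WellFormed G) (acyclic : ¬ HasCycle G) where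

  Adj : Fin n → Fin n → Set
  Adj x y = T (Graph.E G x y)

  IsPath : List (Fin n) → Set
  IsPath xs = Unique xs × Linked Adj xs

  adj-sym : ∀ {x y} → Adj x y → Adj y x
  adj-sym {x} {y} = subst T (proj₁ wellFormed x y)

  adj-irrefl : ∀ {x} → ¬ Adj x x
  adj-irrefl {x} = subst T (proj₁ (proj₂ wellFormed) x)

  adj⇒vertex : ∀ {x y} → Adj x y → T (Graph.V G x)
  adj⇒vertex {x} {y} = proj₂ (proj₂ wellFormed) x y

  edge-path : ∀ {x y} → Adj x y → IsPath (x ∷ y ∷ [])
  edge-path x~y = ((λ { refl → adj-irrefl x~y }) All.∷ All.[]) ∷ (All.[] ∷ []) , x~y ∷ [-]

  path-reverse : ∀ {xs} → IsPath xs → IsPath (reverse xs)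
  path-reverse (unique , linked) =
    unique-reverse unique , Linked.map adj-sym (linked-reverse linked)

  path-cannot-close : ∀ {a b cs} → IsPath (a ∷ b ∷ cs) → (k : Fin (length cs)) →
                      ¬ Adj (lookup cs k) a
  path-cannot-close {a} {b} {cs} (unique , linked) k closing =
    acyclic (toℕ k , cycle , injective , consecutive , closing′)
    where
    fits : 3 + toℕ k ≤ length (a ∷ b ∷ cs)
    fits = s≤s (s≤s (toℕ<n k))

    cycle : Fin (3 + toℕ k) → Fin n
    cycle i = lookup (a ∷ b ∷ cs) (inject≤ i fits)

    injective : Injective _≡_ _≡_ cycle
    injective eq = inject≤-injective fits fits _ _ (lookup-injective unique eq)

    consecutive : ∀ i → Adj (cycle (inject₁ i)) (cycle (suc i))
    consecutive i = lookup-linked linked _ _ (begin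
      toℕ (inject≤ (suc i) fits)           ≡⟨ toℕ-inject≤ (suc i) fits ⟩
      suc (toℕ i)                          ≡⟨ cong suc (toℕ-inject₁ i) ⟨
      suc (toℕ (inject₁ i))                ≡⟨ cong suc (toℕ-inject≤ (inject₁ i) fits) ⟨
      suc (toℕ (inject≤ (inject₁ i) fits)) ∎)
      where open ≡-Reasoning

    last-is-k : inject≤ (fromℕ (2 + toℕ k)) fits ≡ suc (suc k)
    last-is-k = toℕ-injective (trans (toℕ-inject≤ _ fits) (toℕ-fromℕ _))

    closing′ : Adj (cycle (fromℕ (2 + toℕ k))) (cycle zero)
    closing′ = subst (λ j → Adj (lookup (a ∷ b ∷ cs) j) a) (sym last-is-k) closing

  path-extend : ∀ {x p q ws} → IsPath (x ∷ p ∷ ws) → Adj x q → q ≢ p → IsPath (q ∷ x ∷ p ∷ ws)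
  path-extend {x} {p} {q} {ws} path@(unique , linked) x~q q≢p =
    (q≢x All.∷ q≢p All.∷ All.tabulate q∉ws) ∷ unique , adj-sym x~q ∷ linked
    where
    q≢x : q ≢ x
    q≢x refl = adj-irrefl x~q

    q∉ws : ∀ {w} → w ∈ ws → q ≢ w
    q∉ws w∈ws refl =
      path-cannot-close path (index w∈ws)
        (subst (λ v → Adj v x) (Any.lookup-index w∈ws) (adj-sym x~q))

  leaf-or-branch : ∀ {x} p → T (Graph.V G x) → IsLeaf G x ⊎ ∃ λ q → Adj x q × q ≢ p
  leaf-or-branch {x} p x∈G with any? (λ q → T? (Graph.E G x q) ×-dec ¬? (q ≟ p))
  ... | yes branch = inj₂ branch
  ... | no ¬branch = inj₁ (x∈G , λ v w x~v x~w → trans (only-p x~v) (sym (only-p x~w)))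
    where
    only-p : ∀ {v} → Adj x v → v ≡ p
    only-p {v} x~v = decidable-stable (v ≟ p) (λ v≢p → ¬branch (v , x~v , v≢p))

  module _ (F : ESet n) {u} (incident : IncidentTo F G u) (C : VSet n)
           (closed : ∀ {x q} → T (C x) → Adj x q → T (not (F x q)) → T (C q)) where

    LeafIn : Set
    LeafIn = ∃ λ v → T (C v) × IsLeaf G v

    extend-to-leaf-or-centre : ∀ fuel {x p ws} → n < fuel + length (x ∷ p ∷ ws) →
                               IsPath (x ∷ p ∷ ws) → T (C x) →
                               LeafIn ⊎ ∃ λ front → IsPath (front ++ p ∷ ws) × u ∈ front
    extend-to-leaf-or-centre zero bound (unique , _) _ =
      ⊥-elim (<⇒≱ bound (unique⇒length≤ unique))
    extend-to-leaf-or-centre (suc fuel) {x} {p} {ws} bound path@(_ , x~p ∷ _) x∈C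
      with leaf-or-branch p (adj⇒vertex x~p)
    ... | inj₁ leaf = inj₁ (x , x∈C , leaf)
    ... | inj₂ (q , x~q , q≢p) with T-or-T-not (F x q)
    ...   | inj₁ blocked =
            inj₂ (q ∷ x ∷ [] , path-extend path x~q q≢p ,
                  [ there ∘ here ∘ sym , here ∘ sym ] (incident x q blocked x~q))
    ...   | inj₂ unblocked
            with extend-to-leaf-or-centre fuel (subst (n <_) (sym (+-suc fuel _)) bound)
                   (path-extend path x~q q≢p) (closed x∈C x~q unblocked)
    ...     | inj₁ leaf = inj₁ leaf
    ...     | inj₂ (front , path′ , u∈front) =
              inj₂ (front ∷ʳ x , subst IsPath (sym (∷ʳ-++ front x (p ∷ ws))) path′ , ∈-++⁺ˡ u∈front)

    unblocked-edge-reaches-leaf : ∀ {x y} → T (C x) → Adj x y → T (not (F x y)) → LeafIn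
    unblocked-edge-reaches-leaf {x} {y} x∈C x~y unblocked
      -- extend from y away from x, then extend the reversed path from x away from y
      with extend-to-leaf-or-centre n (m<m+n n z<s) (edge-path (adj-sym x~y))
             (closed x∈C x~y unblocked)
    ... | inj₁ leaf = leaf
    ... | inj₂ (front , path , u∈front)
      with reverse front | subst IsPath (reverse-++ front (x ∷ [])) (path-reverse path)
         | Any.reverse⁺ u∈front
    ...   | []     | _        | ()
    ...   | p ∷ ws | reversed | u∈back with extend-to-leaf-or-centre n (m<m+n n z<s) reversed x∈C
    ...     | inj₁ leaf = leaf
    ...     | inj₂ (front′ , (unique , _) , u∈front′) =
              ⊥-elim (unique-++-disjoint front′ unique u∈front′ u∈back)

module _ {n k} (P : Profile n k) {F : ESet n} {C : VSet n}
         (component : IsComponent (displayGraph P) (minus (displayGraph P) F) C) where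
  open Profile P

  component-closed-under-tree-edges : ∀ i {v w} → T (C v) → T (Graph.E (tree i) v w) →
                                      T (not (F v w)) → T (C w)
  component-closed-under-tree-edges i {v} {w} v∈C v~w vw∉F =
    proj₂ (proj₂ (proj₂ component)) v w v∈C
      (anyFin-intro _ i (adj⇒vertex (adj-sym v~w)))
      (step (from T-∧ (anyFin-intro _ i v~w , vw∉F)) here)
    where open Forest (tree i) (proj₁ (isTree i)) (proj₂ (proj₂ (proj₂ (isTree i))))

  component-has-label : IsNiceCut P F → ∃ (LabelsIn P C)
  component-has-label (_ , centre , has-edge)
    with x , y , x∈C , xy∈G-F ← has-edge C component
    with xy∈G , xy∉F ← to T-∧ xy∈G-F
    with i , x~y ← anyFin-elim _ xy∈G
    with u , _ , incident ← centre i
    with wellFormed , _ , _ , acyclic ← isTree i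
    with v , v∈C , leaf ← Forest.unblocked-edge-reaches-leaf (tree i) wellFormed acyclic
                            F incident C (component-closed-under-tree-edges i) x∈C x~y xy∉F
    = v , v∈C , i , leaf

lemma10 : ∀ {n k : ℕ} (P : Profile n k) →
    Connected (displayGraph P) →
    (F : ESet n) →
    IsNiceCut P F →
    IsMinimalCut (displayGraph P) F →
    (G₁ G₂ : VSet n) →
    IsComponent (displayGraph P) (minus (displayGraph P) F) G₁ →
    IsComponent (displayGraph P) (minus (displayGraph P) F) G₂ →
    (∀ (v : Fin n) → ¬ (T (G₁ v) × T (G₂ v))) →
    (∀ (v : Fin n) → T (Graph.V (displayGraph P) v) → T (G₁ v) ⊎ T (G₂ v)) →
    IsSplit P (LabelsIn P G₁) (LabelsIn P G₂)
lemma10 P _ F nice _ G₁ G₂ component₁ component₂ disjoint cover =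
  component-has-label P component₁ nice , component-has-label P component₂ nice ,
  (λ v v∈₁ v∈₂ → disjoint v (proj₁ v∈₁ , proj₁ v∈₂)) ,
  (λ _ → proj₂) , (λ _ → proj₂) , label-on-some-side
  where
  label-on-some-side : ∀ v → InLabels P v → LabelsIn P G₁ v ⊎ LabelsIn P G₂ v
  label-on-some-side v (i , leaf) with cover v (anyFin-intro _ i (proj₁ leaf))
  ... | inj₁ v∈G₁ = inj₁ (v∈G₁ , i , leaf)
  ... | inj₂ v∈G₂ = inj₂ (v∈G₂ , i , leaf)
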